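{- Let $k\ge4$ be an integer and $n\ge1$. Then $\ell_{\mathbb{Z}[i\sqrt{k}]}=\ell_{(\mathbb{Z}[i\sqrt{k}])[X_1,\dots,X_n]}=4$.
   Context: All rings are commutative, unitary and nonzero. For a ring $B$ and $a_1,\dots,a_n\in B$, set $M_n(a_1,\dots,a_n)=\begin{pmatrix}a_n&-1\\1&0\end{pmatrix}\cdots\begin{pmatrix}a_1&-1\\1&0\end{pmatrix}$. An $n$-tuple $(a_1,\dots,a_n)\in B^n$ is a $\lambda$-quiddity over $B$ if $M_n(a_1,\dots,a_n)=\epsilon\,\mathrm{Id}$ for some $\epsilon\in\{\pm1_B\}$. For $(a_1,\dots,a_n)\in B^n$, $(b_1,\dots,b_m)\in B^m$ define $(a_1,\dots,a_n)\oplus(b_1,\dots,b_m)=(a_1+b_m,a_2,\dots,a_{n-1},a_n+b_1,b_2,\dots,b_{m-1})$. Two $n$-tuples are equivalent ($\sim$) if one is obtained from the other or from its reversal by a cyclic rotation. A $\lambda$-quiddity $(c_1,\dots,c_n)$ with $n\ge3$ is reducible if there exist a $\lambda$-quiddity $(b_1,\dots,b_l)$ and $(a_1,\dots,a_m)\in B^m$ with $m,l\ge3$ and $(c_1,\dots,c_n)\sim(a_1,\dots,a_m)\oplus(b_1,\dots,b_l)$; otherwise it is irreducible ($(0,0)$ is never irreducible). $\ell_B$ is the maximal size of irreducible $\lambda$-quiddities over $B$ if bounded, and $+\infty$ otherwise. $\mathbb{Z}[i\sqrt{k}]$ is the subring of $\mathbb{C}$ generated by $i\sqrt{k}$. -}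

module Defs where

open import Level using (0ℓ)
open import Algebra.Bundles.Raw using (RawRing)
open import Data.Nat as ℕ using (ℕ; zero; suc; _≤_)
open import Data.Integer as ℤ using (ℤ)
open import Data.Product using (_×_; _,_; ∃; ∃-syntax)
open import Data.Sum using (_⊎_)
open import Data.List using (List; []; _∷_; [_]; _++_; length; map; reverse; take; drop)
open import Data.List.Relation.Binary.Pointwise using (Pointwise)
open import Relation.Nullary using (¬_)
open import Relation.Binary.PropositionalEquality using (_≡_)

-- The ring ℤ[i√k] = { a + b·i√k : a, b ∈ ℤ }, represented by pairs (a , b).
-- Since i√k has minimal polynomial X² + k over ℤ, {1, i√k} is a ℤ-basis,
-- so (a , b) ↦ a + b i√k is a bijection ℤ × ℤ → ℤ[i√k], and
-- (a + b i√k)(c + d i√k) = (ac - k bd) + (ad + bc) i√k.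

ℤ[i√_] : ℕ → RawRing 0ℓ 0ℓ
ℤ[i√ k ] = record
  { Carrier = ℤ × ℤ
  ; _≈_     = _≡_
  ; _+_     = λ { (a , b) (c , d) → (a ℤ.+ c , b ℤ.+ d) }
  ; _*_     = λ { (a , b) (c , d) →
                  (a ℤ.* c ℤ.- ℤ.+ k ℤ.* (b ℤ.* d) , a ℤ.* d ℤ.+ b ℤ.* c) }
  ; -_      = λ { (a , b) → (ℤ.- a , ℤ.- b) }
  ; 0#      = (ℤ.+ 0 , ℤ.+ 0)
  ; 1#      = (ℤ.+ 1 , ℤ.+ 0)
  }

-- Univariate polynomial ring R[X]: coefficient lists (constant term first),
-- equal when they agree up to trailing zero coefficients.

module PolyDef (R : RawRing 0ℓ 0ℓ) where
  open RawRing R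

  P : Set
  P = List Carrier

  data _≈P_ : P → P → Set where
    []≈[] : [] ≈P []
    []≈∷  : ∀ {b bs} → b ≈ 0# → [] ≈P bs → [] ≈P (b ∷ bs)
    ∷≈[]  : ∀ {a as} → a ≈ 0# → as ≈P [] → (a ∷ as) ≈P []
    ∷≈∷   : ∀ {a as b bs} → a ≈ b → as ≈P bs → (a ∷ as) ≈P (b ∷ bs)

  _+P_ : P → P → P
  [] +P q = q
  (a ∷ p) +P [] = a ∷ p
  (a ∷ p) +P (b ∷ q) = (a + b) ∷ (p +P q)

  _*P_ : P → P → P
  [] *P q = []
  (a ∷ p) *P q = map (a *_) q +P (0# ∷ (p *P q))

  -P_ : P → P
  -P p = map -_ p

  PolyRing : RawRing 0ℓ 0ℓ
  PolyRing = record
    { Carrier = P ; _≈_ = _≈P_ ; _+_ = _+P_ ; _*_ = _*P_ ; -_ = -P_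
    ; 0# = [] ; 1# = [ 1# ] }

_[X] : RawRing 0ℓ 0ℓ → RawRing 0ℓ 0ℓ
R [X] = PolyDef.PolyRing R

_[X₁…X_] : RawRing 0ℓ 0ℓ → ℕ → RawRing 0ℓ 0ℓ
R [X₁…X zero ] = R
R [X₁…X suc n ] = (R [X₁…X n ]) [X]

-- λ-quiddities over a ring B (tuples are lists; the size is the length).

module Quiddity (B : RawRing 0ℓ 0ℓ) where
  open RawRing B

  record Mat : Set where
    constructor mat
    field
      m11 m12 m21 m22 : Carrier

  _·_ : Mat → Mat → Mat
  mat a b c d · mat e f g h =
    mat (a * e + b * g) (a * f + b * h) (c * e + d * g) (c * f + d * h)

  η : Carrier → Mat
  η a = mat a (- 1#) 1# 0#

  scalar : Carrier → Mat
  scalar e = mat e 0# 0# e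

  _≈M_ : Mat → Mat → Set
  mat a b c d ≈M mat e f g h = (a ≈ e) × (b ≈ f) × (c ≈ g) × (d ≈ h)

  M : List Carrier → Mat
  M [] = scalar 1#
  M (a ∷ as) = M as · η a

  IsλQuiddity : List Carrier → Set
  IsλQuiddity as = (M as ≈M scalar 1#) ⊎ (M as ≈M scalar (- 1#))

  -- (a₁,…,aₙ) ⊕ (b₁,…,bₘ) = (a₁+bₘ, a₂,…,aₙ₋₁, aₙ+b₁, b₂,…,bₘ₋₁)
  -- (only used for n, m ≥ 3; degenerate inputs give arbitrary output)
  lastOr : Carrier → List Carrier → Carrier
  lastOr d [] = d
  lastOr d (x ∷ xs) = lastOr x xs

  initL : List Carrier → List Carrier
  initL [] = []
  initL (x ∷ []) = []
  initL (x ∷ y ∷ xs) = x ∷ initL (y ∷ xs)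

  _⊕_ : List Carrier → List Carrier → List Carrier
  (a₁ ∷ a₂ ∷ as) ⊕ (b₁ ∷ b₂ ∷ bs) =
    (a₁ + lastOr b₂ bs) ∷ (initL (a₂ ∷ as) ++ ((lastOr a₂ as + b₁) ∷ initL (b₂ ∷ bs)))
  as ⊕ bs = []

  _≋_ : List Carrier → List Carrier → Set
  _≋_ = Pointwise _≈_

  rotate : ℕ → List Carrier → List Carrier
  rotate r xs = drop r xs ++ take r xs

  _∼_ : List Carrier → List Carrier → Set
  cs ∼ ds = ∃[ r ] ((cs ≋ rotate r ds) ⊎ (cs ≋ rotate r (reverse ds)))

  Reducible : List Carrier → Set
  Reducible cs = ∃[ bs ] ∃[ as ]
    (IsλQuiddity bs × 3 ≤ length bs × 3 ≤ length as × (cs ∼ (as ⊕ bs)))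

  Irreducible : List Carrier → Set
  Irreducible cs = IsλQuiddity cs × 3 ≤ length cs × ¬ Reducible cs

  ℓ≡ : ℕ → Set
  ℓ≡ v = (∃[ cs ] (Irreducible cs × length cs ≡ v))
       × (∀ cs → Irreducible cs → length cs ≤ v)

ℓ[_]≡_ : RawRing 0ℓ 0ℓ → ℕ → Set
ℓ[ B ]≡ v = Quiddity.ℓ≡ B v

module Submission where

-- Call a commutative ring a growth domain if it is a domain in which every element other
-- than 0, 1, -1 is "large", and which carries a strict relation ≻ such that u ≻ v implies
-- u a - v ≻ u for large a. Multiplying M(a₂,…,aₙ) on the right by η(a₁) turns its bottom row
-- (r , s) into (r a₁ + s , - r), so if all entries of a λ-quiddity were large, r ≻ - s would
-- hold throughout and r ≠ 0, whereas M = ± Id. Hence every λ-quiddity contains 0 or ±1;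
-- splitting off (ε,ε,ε) or (0,c,0,-c) there reduces it as soon as its size is at least 5,
-- while (0,0,0,0) is irreducible. ℤ[i√k] with k ≥ 4 is a growth domain for the norm a² + k b²
-- (anything with b ≠ 0 has norm at least 4), and R ↦ R[X] preserves growth domains by comparing
-- degrees first and leading coefficients second.

open import Defs
open import Level using (0ℓ)
open import Algebra.Bundles using (CommutativeRing)
open import Algebra.Bundles.Raw using (RawRing)
open import Algebra.Structures using (IsCommutativeRing)
open import Data.Empty using (⊥)
open import Data.Nat as ℕ using (ℕ; zero; suc; _≤_; _<_; z≤n; s≤s; s≤s⁻¹)
import Data.Nat.Properties as ℕ
import Data.Nat.Tactic.RingSolver as ℕ-Solver
open import Data.Integer as ℤ using (ℤ; +_; -[1+_]; ∣_∣)
import Data.Integer.Properties as ℤ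
import Data.Integer.Tactic.RingSolver as ℤ-Solver
open import Data.List
  using (List; []; _∷_; [_]; _++_; _∷ʳ_; length; map; take; drop; reverse; initLast; _∷ʳ′_)
open import Data.List.Properties
  using (++-assoc; length-++; length-++-≤ʳ; length-++-sucʳ; length-++-comm; length-reverse; take++drop≡id)
open import Data.List.Membership.Propositional using (find)
open import Data.List.Membership.Propositional.Properties using (∈-∃++)
open import Data.List.Relation.Binary.Pointwise as Pointwise using (Pointwise; []; _∷_)
open import Data.List.Relation.Unary.All as All using (All; _∷_)
open import Data.List.Relation.Unary.Any using (Any; here; there)
import Data.List.Relation.Unary.Any.Properties as Any
open import Data.Maybe using (Maybe; just; nothing)
open import Data.Product using (_×_; _,_; proj₁; ∃₂)
open import Data.Product.Properties using (≡-dec)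
open import Data.Sum using (_⊎_; inj₁; inj₂)
open import Function using (_∘_)
open import Relation.Binary.Bundles using (Setoid)
open import Relation.Binary.PropositionalEquality as ≡ using (_≡_; _≢_)
import Relation.Binary.Reasoning.Setoid as SetoidReasoning
open import Relation.Nullary using (¬_; Dec; yes; no; contradiction)

IsCommutativeRawRing : RawRing 0ℓ 0ℓ → Set
IsCommutativeRawRing R = IsCommutativeRing _≈_ _+_ _*_ -_ 0# 1#
  where open RawRing R

toCommutativeRing : ∀ {R} → IsCommutativeRawRing R → CommutativeRing 0ℓ 0ℓ
toCommutativeRing isCommutativeRing = record { isCommutativeRing = isCommutativeRing }

-- Integer coefficients let the solver normalise numerals, e.g. 1# + - 1# to 0#.
module IntegerCoefficients (R : CommutativeRing 0ℓ 0ℓ) where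

  open CommutativeRing R
  open import Algebra.Properties.Ring ring using (-0#≈0#; -‿involutive; -‿distribˡ-*; -‿distribʳ-*)
  open import Algebra.Properties.AbelianGroup +-abelianGroup using (⁻¹-∙-comm; xyx⁻¹≈y)
  open import Algebra.Properties.Semiring.Mult.TCOptimised semiring
    using (×-homo-+; ×1-homo-*) renaming (_×_ to _×′_)
  open import Algebra.Solver.Ring.AlmostCommutativeRing
    using (fromCommutativeRing; _-Raw-AlmostCommutative⟶_)
  open import Relation.Binary.Reasoning.Setoid setoid

  fromℤ : ℤ → Carrier
  fromℤ (+ n) = n ×′ 1#
  fromℤ -[1+ n ] = - (suc n ×′ 1#)

  fromℤ-neg : ∀ i → fromℤ (ℤ.- i) ≈ - fromℤ i
  fromℤ-neg (+ zero) = sym -0#≈0#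
  fromℤ-neg (+ suc n) = refl
  fromℤ-neg -[1+ n ] = sym (-‿involutive _)

  fromℤ-⊖ : ∀ m n → fromℤ (m ℤ.⊖ n) ≈ m ×′ 1# - n ×′ 1#
  fromℤ-⊖ m zero = sym (trans (+-congˡ -0#≈0#) (+-identityʳ _))
  fromℤ-⊖ zero (suc n) = sym (+-identityˡ _)
  fromℤ-⊖ (suc m) (suc n) = begin
    fromℤ (suc m ℤ.⊖ suc n)            ≡⟨ ≡.cong fromℤ (ℤ.[1+m]⊖[1+n]≡m⊖n m n) ⟩
    fromℤ (m ℤ.⊖ n)                    ≈⟨ fromℤ-⊖ m n ⟩
    m ×′ 1# - n ×′ 1#                  ≈⟨ +-congʳ (xyx⁻¹≈y 1# (m ×′ 1#)) ⟨
    1# + m ×′ 1# + - 1# - n ×′ 1#      ≈⟨ +-assoc _ _ _ ⟩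
    1# + m ×′ 1# + (- 1# - n ×′ 1#)    ≈⟨ +-congˡ (⁻¹-∙-comm 1# (n ×′ 1#)) ⟩
    1# + m ×′ 1# - (1# + n ×′ 1#)      ≈⟨ +-cong (×-homo-+ 1# 1 m) (-‿cong (×-homo-+ 1# 1 n)) ⟨
    suc m ×′ 1# - suc n ×′ 1#          ∎

  fromℤ-+ : ∀ i j → fromℤ (i ℤ.+ j) ≈ fromℤ i + fromℤ j
  fromℤ-+ (+ m) (+ n) = ×-homo-+ 1# m n
  fromℤ-+ (+ m) -[1+ n ] = fromℤ-⊖ m (suc n)
  fromℤ-+ -[1+ m ] (+ n) = trans (fromℤ-⊖ n (suc m)) (+-comm _ _)
  fromℤ-+ -[1+ m ] -[1+ n ] = begin
    - (suc (suc (m ℕ.+ n)) ×′ 1#)      ≡⟨ ≡.cong (λ k → - (suc k ×′ 1#)) (ℕ.+-suc m n) ⟨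
    - ((suc m ℕ.+ suc n) ×′ 1#)        ≈⟨ -‿cong (×-homo-+ 1# (suc m) (suc n)) ⟩
    - (suc m ×′ 1# + suc n ×′ 1#)      ≈⟨ ⁻¹-∙-comm _ _ ⟨
    - (suc m ×′ 1#) + - (suc n ×′ 1#)  ∎

  fromℤ-+* : ∀ m j → fromℤ (+ m ℤ.* j) ≈ m ×′ 1# * fromℤ j
  fromℤ-+* m (+ n) = trans (reflexive (≡.cong fromℤ (≡.sym (ℤ.pos-* m n)))) (×1-homo-* m n)
  fromℤ-+* m -[1+ n ] = begin
    fromℤ (+ m ℤ.* -[1+ n ])           ≡⟨ ≡.cong fromℤ (ℤ.neg-distribʳ-* (+ m) (+ suc n)) ⟨
    fromℤ (ℤ.- (+ m ℤ.* + suc n))      ≈⟨ fromℤ-neg (+ m ℤ.* + suc n) ⟩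
    - fromℤ (+ m ℤ.* + suc n)          ≈⟨ -‿cong (fromℤ-+* m (+ suc n)) ⟩
    - (m ×′ 1# * suc n ×′ 1#)          ≈⟨ -‿distribʳ-* _ _ ⟩
    m ×′ 1# * - (suc n ×′ 1#)          ∎

  fromℤ-* : ∀ i j → fromℤ (i ℤ.* j) ≈ fromℤ i * fromℤ j
  fromℤ-* (+ m) j = fromℤ-+* m j
  fromℤ-* -[1+ m ] j = begin
    fromℤ (-[1+ m ] ℤ.* j)             ≡⟨ ≡.cong fromℤ (ℤ.neg-distribˡ-* (+ suc m) j) ⟨
    fromℤ (ℤ.- (+ suc m ℤ.* j))        ≈⟨ fromℤ-neg (+ suc m ℤ.* j) ⟩
    - fromℤ (+ suc m ℤ.* j)            ≈⟨ -‿cong (fromℤ-+* (suc m) j) ⟩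
    - (suc m ×′ 1# * fromℤ j)          ≈⟨ -‿distribˡ-* _ _ ⟩
    - (suc m ×′ 1#) * fromℤ j          ∎

  fromℤ-homomorphism : ℤ.+-*-rawRing -Raw-AlmostCommutative⟶ fromCommutativeRing R
  fromℤ-homomorphism = record
    { ⟦_⟧ = fromℤ ; +-homo = fromℤ-+ ; *-homo = fromℤ-* ; -‿homo = fromℤ-neg
    ; 0-homo = refl ; 1-homo = refl }

  fromℤ-≟ : ∀ i j → Maybe (fromℤ i ≈ fromℤ j)
  fromℤ-≟ i j with i ℤ.≟ j
  ... | yes ≡.refl = just refl
  ... | no _ = nothing

  open import Algebra.Solver.Ring ℤ.+-*-rawRing (fromCommutativeRing R) fromℤ-homomorphism fromℤ-≟
    public using (Polynomial; con; _:+_; _:*_; :-_; _:=_; solve)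

  0ᶠ 1ᶠ : ∀ {n} → Polynomial n
  0ᶠ = con (+ 0)
  1ᶠ = con (+ 1)

module _ {A B : Set} {_∼_ : A → B → Set} where

  drop⁺ : ∀ n {xs ys} → Pointwise _∼_ xs ys → Pointwise _∼_ (drop n xs) (drop n ys)
  drop⁺ zero xs∼ys = xs∼ys
  drop⁺ (suc n) [] = []
  drop⁺ (suc n) (x∼y ∷ xs∼ys) = drop⁺ n xs∼ys

  take⁺ : ∀ n {xs ys} → Pointwise _∼_ xs ys → Pointwise _∼_ (take n xs) (take n ys)
  take⁺ zero xs∼ys = []
  take⁺ (suc n) [] = []
  take⁺ (suc n) (x∼y ∷ xs∼ys) = x∼y ∷ take⁺ n xs∼ys

module _ {A : Set} where

  drop-length-++ : ∀ (xs ys : List A) → drop (length xs) (xs ++ ys) ≡ ys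
  drop-length-++ [] ys = ≡.refl
  drop-length-++ (x ∷ xs) ys = drop-length-++ xs ys

  take-length-++ : ∀ (xs ys : List A) → take (length xs) (xs ++ ys) ≡ xs
  take-length-++ [] ys = ≡.refl
  take-length-++ (x ∷ xs) ys = ≡.cong (x ∷_) (take-length-++ xs ys)

Small : (R : RawRing 0ℓ 0ℓ) → RawRing.Carrier R → Set
Small R a = a ≈ 0# ⊎ a ≈ 1# ⊎ a ≈ - 1#
  where open RawRing R

module CommutativeRingQuiddities (R : RawRing 0ℓ 0ℓ) (isCommutativeRing : IsCommutativeRawRing R) where

  open RawRing R
  open Quiddity R
  open Mat
  open CommutativeRing (toCommutativeRing isCommutativeRing) using (refl; sym; trans; -‿cong; ring; _-_)
  open import Algebra.Properties.Ring ring using (-0#≈0#; -‿involutive)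
  open IntegerCoefficients (toCommutativeRing isCommutativeRing)

  -- M over the solver's formal polynomials evaluates definitionally to M over R, so the solver
  -- can compute the entries of M for explicit tuples.
  formal : ℕ → RawRing 0ℓ 0ℓ
  formal n = record
    { Carrier = Polynomial n ; _≈_ = _≡_ ; _+_ = _:+_ ; _*_ = _:*_ ; -_ = :-_
    ; 0# = 0ᶠ ; 1# = 1ᶠ }

  open module Formal {n} = Quiddity (formal n) using () renaming (M to Mᶠ; Mat to Matᶠ)

  M-0x0y : ∀ x y → M (0# ∷ x ∷ 0# ∷ y ∷ []) ≈M mat 1# (x + y) 0# 1#
  M-0x0y x y =
      solve 2 (λ x y → Matᶠ.m11 (Mᶠ (0ᶠ ∷ x ∷ 0ᶠ ∷ y ∷ [])) := 1ᶠ) refl x y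
    , solve 2 (λ x y → Matᶠ.m12 (Mᶠ (0ᶠ ∷ x ∷ 0ᶠ ∷ y ∷ [])) := x :+ y) refl x y
    , solve 2 (λ x y → Matᶠ.m21 (Mᶠ (0ᶠ ∷ x ∷ 0ᶠ ∷ y ∷ [])) := 0ᶠ) refl x y
    , solve 2 (λ x y → Matᶠ.m22 (Mᶠ (0ᶠ ∷ x ∷ 0ᶠ ∷ y ∷ [])) := 1ᶠ) refl x y

  λ-quiddity-0x0y : ∀ x y → x + y ≈ 0# → IsλQuiddity (0# ∷ x ∷ 0# ∷ y ∷ [])
  λ-quiddity-0x0y x y x+y≈0 with M-0x0y x y
  ... | m11≈1 , m12≈x+y , m21≈0 , m22≈1 = inj₁ (m11≈1 , trans m12≈x+y x+y≈0 , m21≈0 , m22≈1)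

  λ-quiddity-111 : IsλQuiddity (1# ∷ 1# ∷ 1# ∷ [])
  λ-quiddity-111 = inj₂
    ( solve 0 (Matᶠ.m11 (Mᶠ (1ᶠ ∷ 1ᶠ ∷ 1ᶠ ∷ [])) := :- 1ᶠ) refl
    , solve 0 (Matᶠ.m12 (Mᶠ (1ᶠ ∷ 1ᶠ ∷ 1ᶠ ∷ [])) := 0ᶠ) refl
    , solve 0 (Matᶠ.m21 (Mᶠ (1ᶠ ∷ 1ᶠ ∷ 1ᶠ ∷ [])) := 0ᶠ) refl
    , solve 0 (Matᶠ.m22 (Mᶠ (1ᶠ ∷ 1ᶠ ∷ 1ᶠ ∷ [])) := :- 1ᶠ) refl )

  λ-quiddity-[-1][-1][-1] : IsλQuiddity (- 1# ∷ - 1# ∷ - 1# ∷ [])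
  λ-quiddity-[-1][-1][-1] = inj₁
    ( solve 0 (Matᶠ.m11 (Mᶠ (:- 1ᶠ ∷ :- 1ᶠ ∷ :- 1ᶠ ∷ [])) := 1ᶠ) refl
    , solve 0 (Matᶠ.m12 (Mᶠ (:- 1ᶠ ∷ :- 1ᶠ ∷ :- 1ᶠ ∷ [])) := 0ᶠ) refl
    , solve 0 (Matᶠ.m21 (Mᶠ (:- 1ᶠ ∷ :- 1ᶠ ∷ :- 1ᶠ ∷ [])) := 0ᶠ) refl
    , solve 0 (Matᶠ.m22 (Mᶠ (:- 1ᶠ ∷ :- 1ᶠ ∷ :- 1ᶠ ∷ [])) := 1ᶠ) refl )

  M³-m22 : ∀ x y z → m22 (M (x ∷ y ∷ z ∷ [])) ≈ - y
  M³-m22 = solve 3 (λ x y z → Matᶠ.m22 (Mᶠ (x ∷ y ∷ z ∷ [])) := :- y) refl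

  λ-quiddity³-middle≉0 : ¬ 1# ≈ 0# → ∀ {x y z} → IsλQuiddity (x ∷ y ∷ z ∷ []) → ¬ y ≈ 0#
  λ-quiddity³-middle≉0 1≉0 {x} {y} {z} quiddity y≈0 = absurd quiddity
    where
    m22≈0 : m22 (M (x ∷ y ∷ z ∷ [])) ≈ 0#
    m22≈0 = trans (M³-m22 x y z) (trans (-‿cong y≈0) -0#≈0#)

    absurd : IsλQuiddity (x ∷ y ∷ z ∷ []) → ⊥
    absurd (inj₁ (_ , _ , _ , m22≈1)) = 1≉0 (trans (sym m22≈1) m22≈0)
    absurd (inj₂ (_ , _ , _ , m22≈-1)) =
      1≉0 (trans (sym (-‿involutive 1#)) (trans (-‿cong (trans (sym m22≈-1) m22≈0)) -0#≈0#))

  lastOr-∷ʳ : ∀ d xs y → lastOr d (xs ∷ʳ y) ≡ y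
  lastOr-∷ʳ d [] y = ≡.refl
  lastOr-∷ʳ d (x ∷ xs) y = lastOr-∷ʳ x xs y

  initL-∷ʳ : ∀ xs y → initL (xs ∷ʳ y) ≡ xs
  initL-∷ʳ [] y = ≡.refl
  initL-∷ʳ (x ∷ []) y = ≡.refl
  initL-∷ʳ (x ∷ x′ ∷ xs) y = ≡.cong (x ∷_) (initL-∷ʳ (x′ ∷ xs) y)

  length-initL : ∀ x xs → length (initL (x ∷ xs)) ≡ length xs
  length-initL x [] = ≡.refl
  length-initL x (y ∷ xs) = ≡.cong suc (length-initL y xs)

  ⊕-∷ʳ : ∀ a m ms y b w ws z →
         (a ∷ ((m ∷ ms) ∷ʳ y)) ⊕ (b ∷ ((w ∷ ws) ∷ʳ z)) ≡ (a + z) ∷ (m ∷ ms) ++ (y + b) ∷ w ∷ ws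
  ⊕-∷ʳ a m ms y b w ws z
    rewrite lastOr-∷ʳ w ws z | initL-∷ʳ (m ∷ ms) y | lastOr-∷ʳ m ms y | initL-∷ʳ (w ∷ ws) z = ≡.refl

  length-⊕ : ∀ as bs → 2 ≤ length as → 2 ≤ length bs →
             2 ℕ.+ length (as ⊕ bs) ≡ length as ℕ.+ length bs
  length-⊕ (a₁ ∷ a₂ ∷ as) (b₁ ∷ b₂ ∷ bs) _ _ = ≡.cong (2 ℕ.+_) (begin
    suc (length (initL (a₂ ∷ as) ++ _ ∷ initL (b₂ ∷ bs)))
      ≡⟨ ≡.cong suc (length-++-sucʳ (initL (a₂ ∷ as)) _ _) ⟩
    2 ℕ.+ length (initL (a₂ ∷ as) ++ initL (b₂ ∷ bs))
      ≡⟨ ≡.cong (2 ℕ.+_) (length-++ (initL (a₂ ∷ as))) ⟩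
    2 ℕ.+ (length (initL (a₂ ∷ as)) ℕ.+ length (initL (b₂ ∷ bs)))
      ≡⟨ ≡.cong₂ (λ m n → 2 ℕ.+ (m ℕ.+ n)) (length-initL a₂ as) (length-initL b₂ bs) ⟩
    2 ℕ.+ (length as ℕ.+ length bs)
      ≡⟨ ≡.cong suc (ℕ.+-suc (length as) (length bs)) ⟨
    suc (length as ℕ.+ suc (length bs))
      ≡⟨ ℕ.+-suc (length as) (suc (length bs)) ⟨
    length as ℕ.+ suc (suc (length bs)) ∎)
    where open ≡.≡-Reasoning
  length-⊕ (_ ∷ []) _ (s≤s ()) _
  length-⊕ _ (_ ∷ []) _ (s≤s ())

  rotate⁺ : ∀ r {xs ys} → xs ≋ ys → rotate r xs ≋ rotate r ys
  rotate⁺ r xs≋ys = Pointwise.++⁺ (drop⁺ r xs≋ys) (take⁺ r xs≋ys)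

  rotate-++ : ∀ xs ys → rotate (length xs) (xs ++ ys) ≡ ys ++ xs
  rotate-++ xs ys = ≡.cong₂ _++_ (drop-length-++ xs ys) (take-length-++ xs ys)

  length-rotate : ∀ r xs → length (rotate r xs) ≡ length xs
  length-rotate r xs =
    ≡.trans (length-++-comm (drop r xs) (take r xs)) (≡.cong length (take++drop≡id r xs))

  Any-rotate : ∀ {P : Carrier → Set} r {xs} → Any P xs → Any P (rotate r xs)
  Any-rotate {P} r {xs} any =
    Any.++-comm (take r xs) (drop r xs) (≡.subst (Any P) (≡.sym (take++drop≡id r xs)) any)

  ∼-length : ∀ {cs ds} → cs ∼ ds → length cs ≡ length ds
  ∼-length {ds = ds} (r , inj₁ cs≋) = ≡.trans (Pointwise.Pointwise-length cs≋) (length-rotate r ds)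
  ∼-length {ds = ds} (r , inj₂ cs≋) = ≡.trans (Pointwise.Pointwise-length cs≋)
    (≡.trans (length-rotate r (reverse ds)) (length-reverse ds))

  ∼-Any : ∀ {P : Carrier → Set} → (∀ {x y} → x ≈ y → P x → P y) →
          ∀ {cs ds} → cs ∼ ds → Any P ds → Any P cs
  ∼-Any resp (r , inj₁ cs≋) any =
    Pointwise.Any-resp-Pointwise resp (Pointwise.symmetric sym cs≋) (Any-rotate r any)
  ∼-Any resp (r , inj₂ cs≋) any =
    Pointwise.Any-resp-Pointwise resp (Pointwise.symmetric sym cs≋) (Any-rotate r (Any.reverse⁺ any))

  3≤length : ∀ (a m : Carrier) ms y → 3 ≤ length (a ∷ ((m ∷ ms) ∷ʳ y))
  3≤length a m ms y = s≤s (s≤s (length-++-≤ʳ [ y ] {ms}))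

  reducible-rotate : ∀ r {ts} as bs → IsλQuiddity bs → 3 ≤ length bs → 3 ≤ length as →
                     ts ≋ (as ⊕ bs) → Reducible (rotate r ts)
  reducible-rotate r as bs quiddity 3≤bs 3≤as ts≋ =
    bs , as , quiddity , 3≤bs , 3≤as , r , inj₁ (rotate⁺ r ts≋)

  reducible-unit : ∀ r a m ms y s ε → IsλQuiddity (ε ∷ ε ∷ ε ∷ []) → s ≈ ε →
                   Reducible (rotate r (a ∷ (m ∷ ms) ++ y ∷ s ∷ []))
  reducible-unit r a m ms y s ε quiddity s≈ε =
    reducible-rotate r as (ε ∷ ε ∷ ε ∷ []) quiddity (s≤s (s≤s (s≤s z≤n))) (3≤length (a - ε) m ms (y - ε))
      ts≋as⊕bs
    where
    as = (a - ε) ∷ ((m ∷ ms) ∷ʳ (y - ε))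
    cancel : ∀ x → x - ε + ε ≈ x
    cancel x = solve 2 (λ x e → x :+ :- e :+ e := x) refl x ε
    ts≋as⊕bs : (a ∷ (m ∷ ms) ++ y ∷ s ∷ []) ≋ (as ⊕ (ε ∷ ε ∷ ε ∷ []))
    ts≋as⊕bs rewrite ⊕-∷ʳ (a - ε) m ms (y - ε) ε ε [] ε =
      sym (cancel a) ∷ refl ∷ Pointwise.++⁺ (Pointwise.refl refl) (sym (cancel y) ∷ s≈ε ∷ [])

  reducible-zero : ∀ r a m ms y c s → s ≈ 0# → Reducible (rotate r (a ∷ (m ∷ ms) ++ y ∷ c ∷ s ∷ []))
  reducible-zero r a m ms y c s s≈0 =
    reducible-rotate r as bs (λ-quiddity-0x0y c (- c) c-c≈0) (s≤s (s≤s (s≤s z≤n))) (3≤length (a + c) m ms y)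
      ts≋as⊕bs
    where
    as = (a + c) ∷ ((m ∷ ms) ∷ʳ y)
    bs = 0# ∷ c ∷ 0# ∷ - c ∷ []
    c-c≈0 : c + - c ≈ 0#
    c-c≈0 = solve 1 (λ c → c :+ :- c := 0ᶠ) refl c
    ts≋as⊕bs : (a ∷ (m ∷ ms) ++ y ∷ c ∷ s ∷ []) ≋ (as ⊕ bs)
    ts≋as⊕bs rewrite ⊕-∷ʳ (a + c) m ms y 0# c (0# ∷ []) (- c) =
      solve 2 (λ a c → a := a :+ c :+ :- c) refl a c ∷ refl
        ∷ Pointwise.++⁺ (Pointwise.refl refl) (solve 1 (λ y → y := y :+ 0ᶠ) refl y ∷ refl ∷ s≈0 ∷ [])

  reducible-small-last : ∀ r xs s → 4 ≤ length xs → Small R s → Reducible (rotate r (xs ∷ʳ s))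
  reducible-small-last r xs s 4≤xs small with initLast xs
  reducible-small-last r .[] s () small | []
  ... | ys ∷ʳ′ c with initLast ys
  reducible-small-last r .([] ∷ʳ c) s (s≤s ()) small | .[] ∷ʳ′ c | []
  ... | zs ∷ʳ′ y with zs
  reducible-small-last r _ s (s≤s (s≤s ())) small | _ ∷ʳ′ c | _ ∷ʳ′ y | []
  reducible-small-last r _ s (s≤s (s≤s (s≤s ()))) small | _ ∷ʳ′ c | _ ∷ʳ′ y | a ∷ []
  ... | a ∷ m ∷ ms = ≡.subst (Reducible ∘ rotate r) (≡.sym last-two) (reducible small)
    where
    last-two : (((a ∷ m ∷ ms) ∷ʳ y) ∷ʳ c) ∷ʳ s ≡ ((a ∷ m ∷ ms) ∷ʳ y) ++ c ∷ s ∷ []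
    last-two = ++-assoc ((a ∷ m ∷ ms) ∷ʳ y) [ c ] [ s ]

    reducible : Small R s → Reducible (rotate r (((a ∷ m ∷ ms) ∷ʳ y) ++ c ∷ s ∷ []))
    reducible (inj₁ s≈0) =
      ≡.subst (Reducible ∘ rotate r) (≡.sym (++-assoc (a ∷ m ∷ ms) [ y ] (c ∷ s ∷ [])))
        (reducible-zero r a m ms y c s s≈0)
    reducible (inj₂ (inj₁ s≈1)) =
      reducible-unit r a m (ms ∷ʳ y) c s 1# λ-quiddity-111 s≈1
    reducible (inj₂ (inj₂ s≈-1)) =
      reducible-unit r a m (ms ∷ʳ y) c s (- 1#) λ-quiddity-[-1][-1][-1] s≈-1

  contains-small⇒reducible : ∀ {cs} → 5 ≤ length cs → Any (Small R) cs → Reducible cs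
  contains-small⇒reducible {cs} 5≤cs any with find any
  ... | s , s∈cs , small with ∈-∃++ s∈cs
  ... | pre , post , ≡.refl =
    ≡.subst Reducible rotation (reducible-small-last (length post) (post ++ pre) s 4≤rest small)
    where
    rotation : rotate (length post) ((post ++ pre) ∷ʳ s) ≡ pre ++ s ∷ post
    rotation = begin
      rotate (length post) ((post ++ pre) ∷ʳ s)  ≡⟨ ≡.cong (rotate (length post)) (++-assoc post pre [ s ]) ⟩
      rotate (length post) (post ++ pre ∷ʳ s)    ≡⟨ rotate-++ post (pre ∷ʳ s) ⟩
      (pre ∷ʳ s) ++ post                         ≡⟨ ++-assoc pre [ s ] post ⟩
      pre ++ s ∷ post                            ∎
      where open ≡.≡-Reasoning

    4≤rest : 4 ≤ length (post ++ pre)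
    4≤rest = s≤s⁻¹ (ℕ.≤-trans 5≤cs (ℕ.≤-reflexive
      (≡.trans (length-++-sucʳ pre s post) (≡.cong suc (length-++-comm pre post)))))

  0000-irreducible : ¬ 1# ≈ 0# → Irreducible (0# ∷ 0# ∷ 0# ∷ 0# ∷ [])
  0000-irreducible 1≉0 =
    λ-quiddity-0x0y 0# 0# (solve 0 (0ᶠ :+ 0ᶠ := 0ᶠ) refl) , s≤s (s≤s (s≤s z≤n)) , irreducible
    where
    zeros = 0# ∷ 0# ∷ 0# ∷ 0# ∷ []

    no-nonzero : ¬ Any (λ x → ¬ x ≈ 0#) zeros
    no-nonzero (here 0≉0) = 0≉0 refl
    no-nonzero (there (here 0≉0)) = 0≉0 refl
    no-nonzero (there (there (here 0≉0))) = 0≉0 refl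
    no-nonzero (there (there (there (here 0≉0)))) = 0≉0 refl

    ≉0-resp : ∀ {x y} → x ≈ y → ¬ x ≈ 0# → ¬ y ≈ 0#
    ≉0-resp x≈y x≉0 y≈0 = x≉0 (trans x≈y y≈0)

    no-3+3-split : ∀ as bs → IsλQuiddity bs → length as ≡ 3 → length bs ≡ 3 → ¬ zeros ∼ (as ⊕ bs)
    no-3+3-split (a₁ ∷ a₂ ∷ a₃ ∷ []) (b₁ ∷ b₂ ∷ b₃ ∷ []) quiddity _ _ zeros∼ =
      no-nonzero (∼-Any ≉0-resp zeros∼ (there (there (there (here (λ-quiddity³-middle≉0 1≉0 quiddity))))))

    3+3 : ∀ {m n} → m ℕ.+ n ≡ 6 → 3 ≤ m → 3 ≤ n → m ≡ 3
    3+3 {m} {n} m+n≡6 3≤m 3≤n =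
      ℕ.≤-antisym (ℕ.+-cancelʳ-≤ 3 m 3 (ℕ.≤-trans (ℕ.+-monoʳ-≤ m 3≤n) (ℕ.≤-reflexive m+n≡6))) 3≤m

    irreducible : ¬ Reducible zeros
    irreducible (bs , as , quiddity , 3≤bs , 3≤as , zeros∼) =
      no-3+3-split as bs quiddity (3+3 as+bs≡6 3≤as 3≤bs) (3+3 bs+as≡6 3≤bs 3≤as) zeros∼
      where
      as+bs≡6 : length as ℕ.+ length bs ≡ 6
      as+bs≡6 = ≡.trans (≡.sym (length-⊕ as bs (ℕ.≤-trans (ℕ.n≤1+n 2) 3≤as) (ℕ.≤-trans (ℕ.n≤1+n 2) 3≤bs)))
                        (≡.cong (2 ℕ.+_) (≡.sym (∼-length zeros∼)))
      bs+as≡6 : length bs ℕ.+ length as ≡ 6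
      bs+as≡6 = ≡.trans (ℕ.+-comm (length bs) (length as)) as+bs≡6

module PolynomialRing (R : RawRing 0ℓ 0ℓ) (isCommutativeRing : IsCommutativeRawRing R) where

  open RawRing R

  open PolyDef R
  open CommutativeRing (toCommutativeRing isCommutativeRing)
    using (refl; sym; trans; setoid; +-cong; +-congˡ; +-congʳ; *-congˡ; *-congʳ; -‿cong)
  open IntegerCoefficients (toCommutativeRing isCommutativeRing)

  coeff : P → ℕ → Carrier
  coeff [] n = 0#
  coeff (a ∷ p) zero = a
  coeff (a ∷ p) (suc n) = coeff p n

  infix 4 _≈ᶜ_
  record _≈ᶜ_ (p q : P) : Set where
    constructor coeffwise
    field at : ∀ n → coeff p n ≈ coeff q n
  open _≈ᶜ_ public

  ≈P⇒≈ᶜ : ∀ {p q} → p ≈P q → p ≈ᶜ q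
  ≈P⇒≈ᶜ eq = coeffwise (go eq)
    where
    go : ∀ {p q} → p ≈P q → ∀ n → coeff p n ≈ coeff q n
    go []≈[] n = refl
    go ([]≈∷ b≈0 eq) zero = sym b≈0
    go ([]≈∷ b≈0 eq) (suc n) = go eq n
    go (∷≈[] a≈0 eq) zero = a≈0
    go (∷≈[] a≈0 eq) (suc n) = go eq n
    go (∷≈∷ a≈b eq) zero = a≈b
    go (∷≈∷ a≈b eq) (suc n) = go eq n

  ≈ᶜ⇒≈P : ∀ {p q} → p ≈ᶜ q → p ≈P q
  ≈ᶜ⇒≈P {[]} {[]} eq = []≈[]
  ≈ᶜ⇒≈P {[]} {b ∷ q} eq = []≈∷ (sym (at eq 0)) (≈ᶜ⇒≈P (coeffwise (at eq ∘ suc)))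
  ≈ᶜ⇒≈P {a ∷ p} {[]} eq = ∷≈[] (at eq 0) (≈ᶜ⇒≈P (coeffwise (at eq ∘ suc)))
  ≈ᶜ⇒≈P {a ∷ p} {b ∷ q} eq = ∷≈∷ (at eq 0) (≈ᶜ⇒≈P (coeffwise (at eq ∘ suc)))

  ≈ᶜ-refl : ∀ {p} → p ≈ᶜ p
  ≈ᶜ-refl = coeffwise λ n → refl

  ≈ᶜ-sym : ∀ {p q} → p ≈ᶜ q → q ≈ᶜ p
  ≈ᶜ-sym eq = coeffwise λ n → sym (at eq n)

  ≈ᶜ-trans : ∀ {p q r} → p ≈ᶜ q → q ≈ᶜ r → p ≈ᶜ r
  ≈ᶜ-trans eq eq′ = coeffwise λ n → trans (at eq n) (at eq′ n)

  ≈ᶜ-setoid : Setoid 0ℓ 0ℓ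
  ≈ᶜ-setoid = record
    { Carrier = P ; _≈_ = _≈ᶜ_
    ; isEquivalence = record { refl = ≈ᶜ-refl ; sym = ≈ᶜ-sym ; trans = ≈ᶜ-trans } }

  scale : Carrier → P → P
  scale a = map (a *_)

  coeff-+P : ∀ p q n → coeff (p +P q) n ≈ coeff p n + coeff q n
  coeff-+P [] q n = sym (solve 1 (λ x → 0ᶠ :+ x := x) refl (coeff q n))
  coeff-+P (a ∷ p) [] n = sym (solve 1 (λ x → x :+ 0ᶠ := x) refl (coeff (a ∷ p) n))
  coeff-+P (a ∷ p) (b ∷ q) zero = refl
  coeff-+P (a ∷ p) (b ∷ q) (suc n) = coeff-+P p q n

  coeff--P : ∀ p n → coeff (-P p) n ≈ - coeff p n
  coeff--P [] n = sym (solve 0 (:- 0ᶠ := 0ᶠ) refl)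
  coeff--P (a ∷ p) zero = refl
  coeff--P (a ∷ p) (suc n) = coeff--P p n

  coeff-scale : ∀ a q n → coeff (scale a q) n ≈ a * coeff q n
  coeff-scale a [] n = sym (solve 1 (λ x → x :* 0ᶠ := 0ᶠ) refl a)
  coeff-scale a (b ∷ q) zero = refl
  coeff-scale a (b ∷ q) (suc n) = coeff-scale a q n

  +P-cong : ∀ {p p′ q q′} → p ≈ᶜ p′ → q ≈ᶜ q′ → p +P q ≈ᶜ p′ +P q′
  +P-cong {p} {p′} {q} {q′} eq eq′ = coeffwise λ n → begin
    coeff (p +P q) n       ≈⟨ coeff-+P p q n ⟩
    coeff p n + coeff q n  ≈⟨ +-cong (at eq n) (at eq′ n) ⟩
    coeff p′ n + coeff q′ n ≈⟨ coeff-+P p′ q′ n ⟨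
    coeff (p′ +P q′) n     ∎
    where open SetoidReasoning setoid

  -P-cong : ∀ {p p′} → p ≈ᶜ p′ → -P p ≈ᶜ -P p′
  -P-cong {p} {p′} eq = coeffwise λ n →
    trans (coeff--P p n) (trans (-‿cong (at eq n)) (sym (coeff--P p′ n)))

  +P-assoc : ∀ p q r → (p +P q) +P r ≈ᶜ p +P (q +P r)
  +P-assoc p q r = coeffwise λ n → begin
    coeff ((p +P q) +P r) n              ≈⟨ coeff-+P (p +P q) r n ⟩
    coeff (p +P q) n + coeff r n         ≈⟨ +-congʳ (coeff-+P p q n) ⟩
    coeff p n + coeff q n + coeff r n    ≈⟨ solve 3 (λ x y z → (x :+ y) :+ z := x :+ (y :+ z)) refl _ _ _ ⟩
    coeff p n + (coeff q n + coeff r n)  ≈⟨ +-congˡ (coeff-+P q r n) ⟨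
    coeff p n + coeff (q +P r) n         ≈⟨ coeff-+P p (q +P r) n ⟨
    coeff (p +P (q +P r)) n              ∎
    where open SetoidReasoning setoid

  +P-comm : ∀ p q → p +P q ≈ᶜ q +P p
  +P-comm p q = coeffwise λ n → begin
    coeff (p +P q) n       ≈⟨ coeff-+P p q n ⟩
    coeff p n + coeff q n  ≈⟨ solve 2 (λ x y → x :+ y := y :+ x) refl _ _ ⟩
    coeff q n + coeff p n  ≈⟨ coeff-+P q p n ⟨
    coeff (q +P p) n       ∎
    where open SetoidReasoning setoid

  +P-identityʳ : ∀ p → p +P [] ≈ᶜ p
  +P-identityʳ p = coeffwise λ n →
    trans (coeff-+P p [] n) (solve 1 (λ x → x :+ 0ᶠ := x) refl _)

  -P-inverseˡ : ∀ p → (-P p) +P p ≈ᶜ []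
  -P-inverseˡ p = coeffwise λ n → begin
    coeff ((-P p) +P p) n           ≈⟨ coeff-+P (-P p) p n ⟩
    coeff (-P p) n + coeff p n     ≈⟨ +-congʳ (coeff--P p n) ⟩
    - coeff p n + coeff p n        ≈⟨ solve 1 (λ x → :- x :+ x := 0ᶠ) refl _ ⟩
    0#                             ∎
    where open SetoidReasoning setoid

  -P-inverseʳ : ∀ p → p +P (-P p) ≈ᶜ []
  -P-inverseʳ p = ≈ᶜ-trans (+P-comm p (-P p)) (-P-inverseˡ p)

  +P-interchange : ∀ p q r s → (p +P q) +P (r +P s) ≈ᶜ (p +P r) +P (q +P s)
  +P-interchange p q r s = coeffwise λ n → begin
    coeff ((p +P q) +P (r +P s)) n
      ≈⟨ coeff-+P (p +P q) (r +P s) n ⟩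
    coeff (p +P q) n + coeff (r +P s) n
      ≈⟨ +-cong (coeff-+P p q n) (coeff-+P r s n) ⟩
    (coeff p n + coeff q n) + (coeff r n + coeff s n)
      ≈⟨ solve 4 (λ x y z w → (x :+ y) :+ (z :+ w) := (x :+ z) :+ (y :+ w)) refl _ _ _ _ ⟩
    (coeff p n + coeff r n) + (coeff q n + coeff s n)
      ≈⟨ +-cong (coeff-+P p r n) (coeff-+P q s n) ⟨
    coeff (p +P r) n + coeff (q +P s) n
      ≈⟨ coeff-+P (p +P r) (q +P s) n ⟨
    coeff ((p +P r) +P (q +P s)) n ∎
    where open SetoidReasoning setoid

  scale-congˡ : ∀ {a b} q → a ≈ b → scale a q ≈ᶜ scale b q
  scale-congˡ {a} {b} q a≈b = coeffwise λ n →
    trans (coeff-scale a q n) (trans (*-congʳ a≈b) (sym (coeff-scale b q n)))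

  scale-congʳ : ∀ a {q q′} → q ≈ᶜ q′ → scale a q ≈ᶜ scale a q′
  scale-congʳ a {q} {q′} eq = coeffwise λ n →
    trans (coeff-scale a q n) (trans (*-congˡ (at eq n)) (sym (coeff-scale a q′ n)))

  scale-zero : ∀ {a} q → a ≈ 0# → scale a q ≈ᶜ []
  scale-zero {a} q a≈0 = coeffwise λ n →
    trans (coeff-scale a q n) (trans (*-congʳ a≈0) (solve 1 (λ x → 0ᶠ :* x := 0ᶠ) refl _))

  scale-distribʳ : ∀ a b q → scale (a + b) q ≈ᶜ scale a q +P scale b q
  scale-distribʳ a b q = coeffwise λ n → begin
    coeff (scale (a + b) q) n                  ≈⟨ coeff-scale (a + b) q n ⟩
    (a + b) * coeff q n                        ≈⟨ solve 3 (λ x y z → (x :+ y) :* z := x :* z :+ y :* z) refl _ _ _ ⟩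
    a * coeff q n + b * coeff q n              ≈⟨ +-cong (coeff-scale a q n) (coeff-scale b q n) ⟨
    coeff (scale a q) n + coeff (scale b q) n  ≈⟨ coeff-+P (scale a q) (scale b q) n ⟨
    coeff (scale a q +P scale b q) n           ∎
    where open SetoidReasoning setoid

  scale-distribˡ : ∀ a q r → scale a (q +P r) ≈ᶜ scale a q +P scale a r
  scale-distribˡ a q r = coeffwise λ n → begin
    coeff (scale a (q +P r)) n                 ≈⟨ coeff-scale a (q +P r) n ⟩
    a * coeff (q +P r) n                       ≈⟨ *-congˡ (coeff-+P q r n) ⟩
    a * (coeff q n + coeff r n)                ≈⟨ solve 3 (λ x y z → x :* (y :+ z) := x :* y :+ x :* z) refl _ _ _ ⟩
    a * coeff q n + a * coeff r n              ≈⟨ +-cong (coeff-scale a q n) (coeff-scale a r n) ⟨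
    coeff (scale a q) n + coeff (scale a r) n  ≈⟨ coeff-+P (scale a q) (scale a r) n ⟨
    coeff (scale a q +P scale a r) n           ∎
    where open SetoidReasoning setoid

  scale-assoc : ∀ a b q → scale a (scale b q) ≈ᶜ scale (a * b) q
  scale-assoc a b q = coeffwise λ n → begin
    coeff (scale a (scale b q)) n   ≈⟨ coeff-scale a (scale b q) n ⟩
    a * coeff (scale b q) n         ≈⟨ *-congˡ (coeff-scale b q n) ⟩
    a * (b * coeff q n)             ≈⟨ solve 3 (λ x y z → x :* (y :* z) := (x :* y) :* z) refl _ _ _ ⟩
    a * b * coeff q n               ≈⟨ coeff-scale (a * b) q n ⟨
    coeff (scale (a * b) q) n       ∎
    where open SetoidReasoning setoid

  scale-identity : ∀ q → scale 1# q ≈ᶜ q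
  scale-identity q = coeffwise λ n →
    trans (coeff-scale 1# q n) (solve 1 (λ x → 1ᶠ :* x := x) refl _)

  shift-cong : ∀ {p q} → p ≈ᶜ q → 0# ∷ p ≈ᶜ 0# ∷ q
  shift-cong eq = coeffwise λ { zero → refl ; (suc n) → at eq n }

  shift-+P : ∀ p q → 0# ∷ (p +P q) ≈ᶜ (0# ∷ p) +P (0# ∷ q)
  shift-+P p q = coeffwise λ { zero → solve 0 (0ᶠ := 0ᶠ :+ 0ᶠ) refl ; (suc n) → refl }

  shift-[] : 0# ∷ [] ≈ᶜ []
  shift-[] = coeffwise λ { zero → refl ; (suc n) → refl }

  scale-shift : ∀ a p → scale a (0# ∷ p) ≈ᶜ 0# ∷ scale a p
  scale-shift a p = coeffwise λ { zero → solve 1 (λ x → x :* 0ᶠ := 0ᶠ) refl a ; (suc n) → refl }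

  +P-swap : ∀ p q r → p +P (q +P r) ≈ᶜ q +P (p +P r)
  +P-swap p q r = ≈ᶜ-trans (≈ᶜ-sym (+P-assoc p q r))
    (≈ᶜ-trans (+P-cong (+P-comm p q) ≈ᶜ-refl) (+P-assoc q p r))

  *P-zeroʳ : ∀ p → p *P [] ≈ᶜ []
  *P-zeroʳ [] = ≈ᶜ-refl
  *P-zeroʳ (a ∷ p) = ≈ᶜ-trans (shift-cong (*P-zeroʳ p)) shift-[]

  *P-congʳ : ∀ p {q q′} → q ≈ᶜ q′ → p *P q ≈ᶜ p *P q′
  *P-congʳ [] eq = ≈ᶜ-refl
  *P-congʳ (a ∷ p) eq = +P-cong (scale-congʳ a eq) (shift-cong (*P-congʳ p eq))

  *P-consʳ : ∀ p b q → p *P (b ∷ q) ≈ᶜ scale b p +P (0# ∷ (p *P q))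
  *P-consʳ [] b q = coeffwise λ { zero → refl ; (suc n) → refl }
  *P-consʳ (a ∷ p) b q = coeffwise λ
    { zero → solve 2 (λ x y → x :* y :+ 0ᶠ := y :* x :+ 0ᶠ) refl a b
    ; (suc n) → at (≈ᶜ-trans (+P-cong (≈ᶜ-refl {scale a q}) (*P-consʳ p b q))
                             (+P-swap (scale a q) (scale b p) _)) n }

  *P-comm : ∀ p q → p *P q ≈ᶜ q *P p
  *P-comm [] q = ≈ᶜ-sym (*P-zeroʳ q)
  *P-comm (a ∷ p) q =
    ≈ᶜ-trans (+P-cong ≈ᶜ-refl (shift-cong (*P-comm p q))) (≈ᶜ-sym (*P-consʳ q a p))

  *P-congˡ : ∀ {p p′} q → p ≈ᶜ p′ → p *P q ≈ᶜ p′ *P q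
  *P-congˡ {p} {p′} q eq =
    ≈ᶜ-trans (*P-comm p q) (≈ᶜ-trans (*P-congʳ q eq) (*P-comm q p′))

  *P-distribʳ : ∀ p q r → (q +P r) *P p ≈ᶜ (q *P p) +P (r *P p)
  *P-distribʳ p [] r = ≈ᶜ-refl
  *P-distribʳ p (a ∷ q) [] = ≈ᶜ-sym (+P-identityʳ _)
  *P-distribʳ p (a ∷ q) (b ∷ r) = begin
    scale (a + b) p +P (0# ∷ ((q +P r) *P p))
      ≈⟨ +P-cong (scale-distribʳ a b p) (shift-cong (*P-distribʳ p q r)) ⟩
    (scale a p +P scale b p) +P (0# ∷ ((q *P p) +P (r *P p)))
      ≈⟨ +P-cong ≈ᶜ-refl (shift-+P (q *P p) (r *P p)) ⟩
    (scale a p +P scale b p) +P ((0# ∷ (q *P p)) +P (0# ∷ (r *P p)))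
      ≈⟨ +P-interchange (scale a p) (scale b p) _ _ ⟩
    (scale a p +P (0# ∷ (q *P p))) +P (scale b p +P (0# ∷ (r *P p))) ∎
    where open SetoidReasoning ≈ᶜ-setoid

  *P-distribˡ : ∀ p q r → p *P (q +P r) ≈ᶜ (p *P q) +P (p *P r)
  *P-distribˡ p q r = ≈ᶜ-trans (*P-comm p (q +P r))
    (≈ᶜ-trans (*P-distribʳ p q r) (+P-cong (*P-comm q p) (*P-comm r p)))

  shift-*P : ∀ p q → (0# ∷ p) *P q ≈ᶜ 0# ∷ (p *P q)
  shift-*P p q = +P-cong (scale-zero q refl) ≈ᶜ-refl

  scale-*P : ∀ a p q → (scale a p) *P q ≈ᶜ scale a (p *P q)
  scale-*P a [] q = ≈ᶜ-refl
  scale-*P a (b ∷ p) q = begin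
    scale (a * b) q +P (0# ∷ (scale a p *P q))
      ≈⟨ +P-cong (≈ᶜ-sym (scale-assoc a b q)) (shift-cong (scale-*P a p q)) ⟩
    scale a (scale b q) +P (0# ∷ scale a (p *P q))
      ≈⟨ +P-cong ≈ᶜ-refl (≈ᶜ-sym (scale-shift a (p *P q))) ⟩
    scale a (scale b q) +P scale a (0# ∷ (p *P q))
      ≈⟨ scale-distribˡ a (scale b q) (0# ∷ (p *P q)) ⟨
    scale a (scale b q +P (0# ∷ (p *P q))) ∎
    where open SetoidReasoning ≈ᶜ-setoid

  *P-assoc : ∀ p q r → (p *P q) *P r ≈ᶜ p *P (q *P r)
  *P-assoc [] q r = ≈ᶜ-refl
  *P-assoc (a ∷ p) q r = begin
    (scale a q +P (0# ∷ (p *P q))) *P r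
      ≈⟨ *P-distribʳ r (scale a q) _ ⟩
    (scale a q *P r) +P ((0# ∷ (p *P q)) *P r)
      ≈⟨ +P-cong (scale-*P a q r) (shift-*P (p *P q) r) ⟩
    scale a (q *P r) +P (0# ∷ ((p *P q) *P r))
      ≈⟨ +P-cong ≈ᶜ-refl (shift-cong (*P-assoc p q r)) ⟩
    scale a (q *P r) +P (0# ∷ (p *P (q *P r))) ∎
    where open SetoidReasoning ≈ᶜ-setoid

  *P-identityˡ : ∀ p → [ 1# ] *P p ≈ᶜ p
  *P-identityˡ p = ≈ᶜ-trans (+P-cong (scale-identity p) shift-[]) (+P-identityʳ p)

  isCommutativeRing[X] : IsCommutativeRing _≈P_ _+P_ _*P_ -P_ [] [ 1# ]
  isCommutativeRing[X] = record
    { isRing = record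
      { +-isAbelianGroup = record
        { isGroup = record
          { isMonoid = record
            { isSemigroup = record
              { isMagma = record
                { isEquivalence = record
                  { refl = ≈ᶜ⇒≈P ≈ᶜ-refl
                  ; sym = λ eq → ≈ᶜ⇒≈P (≈ᶜ-sym (≈P⇒≈ᶜ eq))
                  ; trans = λ eq eq′ → ≈ᶜ⇒≈P (≈ᶜ-trans (≈P⇒≈ᶜ eq) (≈P⇒≈ᶜ eq′)) }
                ; ∙-cong = λ eq eq′ → ≈ᶜ⇒≈P (+P-cong (≈P⇒≈ᶜ eq) (≈P⇒≈ᶜ eq′)) }
              ; assoc = λ p q r → ≈ᶜ⇒≈P (+P-assoc p q r) }
            ; identity = (λ p → ≈ᶜ⇒≈P ≈ᶜ-refl) , (λ p → ≈ᶜ⇒≈P (+P-identityʳ p)) }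
          ; inverse = (λ p → ≈ᶜ⇒≈P (-P-inverseˡ p)) , (λ p → ≈ᶜ⇒≈P (-P-inverseʳ p))
          ; ⁻¹-cong = λ eq → ≈ᶜ⇒≈P (-P-cong (≈P⇒≈ᶜ eq)) }
        ; comm = λ p q → ≈ᶜ⇒≈P (+P-comm p q) }
      ; *-cong = λ {p} {p′} {q} {q′} eq eq′ →
          ≈ᶜ⇒≈P (≈ᶜ-trans (*P-congˡ q (≈P⇒≈ᶜ eq)) (*P-congʳ p′ (≈P⇒≈ᶜ eq′)))
      ; *-assoc = λ p q r → ≈ᶜ⇒≈P (*P-assoc p q r)
      ; *-identity = (λ p → ≈ᶜ⇒≈P (*P-identityˡ p))
                   , (λ p → ≈ᶜ⇒≈P (≈ᶜ-trans (*P-comm p [ 1# ]) (*P-identityˡ p)))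
      ; distrib = (λ p q r → ≈ᶜ⇒≈P (*P-distribˡ p q r)) , (λ p q r → ≈ᶜ⇒≈P (*P-distribʳ p q r)) }
    ; *-comm = λ p q → ≈ᶜ⇒≈P (*P-comm p q) }


record GrowthDomain (R : RawRing 0ℓ 0ℓ) : Set₁ where
  open RawRing R
  infix 4 _≻_
  field
    isCommutativeRing : IsCommutativeRawRing R
    _≈0? : ∀ x → Dec (x ≈ 0#)
    1≉0 : ¬ 1# ≈ 0#
    *-≉0 : ∀ {x y} → ¬ x ≈ 0# → ¬ y ≈ 0# → ¬ x * y ≈ 0#
    Large : Carrier → Set
    large-or-small : ∀ a → Large a ⊎ Small R a
    _≻_ : Carrier → Carrier → Set
    ≻-resp-≈ : ∀ {x x′ y y′} → x ≈ x′ → y ≈ y′ → x ≻ y → x′ ≻ y′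
    ≉0⇒≻0 : ∀ {x} → ¬ x ≈ 0# → x ≻ 0#
    ≻⇒≉0 : ∀ {x y} → x ≻ y → ¬ x ≈ 0#
    ≻-grow : ∀ {a u v} → Large a → u ≻ v → u * a + - v ≻ u

module GrowthDomainQuiddities {R : RawRing 0ℓ 0ℓ} (G : GrowthDomain R) where

  open RawRing R
  open GrowthDomain G
  open Quiddity R
  open CommutativeRingQuiddities R isCommutativeRing
  open CommutativeRing (toCommutativeRing isCommutativeRing) using (refl; trans)
  open IntegerCoefficients (toCommutativeRing isCommutativeRing)

  bottom-row-grows : ∀ a as → All Large (a ∷ as) → Mat.m21 (M (a ∷ as)) ≻ - Mat.m22 (M (a ∷ as))
  bottom-row-grows a [] _ = ≻-resp-≈
    (solve 1 (λ a → 1ᶠ := 0ᶠ :* a :+ 1ᶠ :* 1ᶠ) refl a)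
    (solve 0 (0ᶠ := :- (0ᶠ :* :- 1ᶠ :+ 1ᶠ :* 0ᶠ)) refl)
    (≉0⇒≻0 1≉0)
  bottom-row-grows a (a′ ∷ as) (large ∷ larges) = ≻-resp-≈
    (solve 3 (λ r s a → r :* a :+ :- (:- s) := r :* a :+ s :* 1ᶠ) refl r s a)
    (solve 2 (λ r s → r := :- (r :* :- 1ᶠ :+ s :* 0ᶠ)) refl r s)
    (≻-grow large (bottom-row-grows a′ as larges))
    where
    r = Mat.m21 (M (a′ ∷ as))
    s = Mat.m22 (M (a′ ∷ as))

  λ-quiddity-contains-small : ∀ c cs → IsλQuiddity (c ∷ cs) → Any (Small R) (c ∷ cs)
  λ-quiddity-contains-small c cs quiddity with All.decide large-or-small (c ∷ cs)
  ... | inj₂ small = small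
  ... | inj₁ larges = contradiction (m21≈0 quiddity) (≻⇒≉0 (bottom-row-grows c cs larges))
    where
    m21≈0 : IsλQuiddity (c ∷ cs) → Mat.m21 (M (c ∷ cs)) ≈ 0#
    m21≈0 (inj₁ (_ , _ , m21≈0 , _)) = m21≈0
    m21≈0 (inj₂ (_ , _ , m21≈0 , _)) = m21≈0

  ℓ≡4 : ℓ≡ 4
  ℓ≡4 = (_ , 0000-irreducible 1≉0 , ≡.refl) , bound
    where
    bound : ∀ cs → Irreducible cs → length cs ≤ 4
    bound [] _ = z≤n
    bound (c ∷ cs) (quiddity , _ , irreducible) with length (c ∷ cs) ℕ.≤? 4
    ... | yes ≤4 = ≤4
    ... | no ≰4 = contradiction
      (contains-small⇒reducible (ℕ.≰⇒> ≰4) (λ-quiddity-contains-small c cs quiddity)) irreducible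

module GrowthDomain[X] {R : RawRing 0ℓ 0ℓ} (G : GrowthDomain R) where

  open RawRing R
  open GrowthDomain G
  open PolyDef R
  open PolynomialRing R isCommutativeRing
  open CommutativeRing (toCommutativeRing isCommutativeRing)
    using (refl; sym; trans; +-cong; *-congˡ; *-congʳ; -‿cong; +-identityʳ; zeroʳ; ring)
  open import Algebra.Properties.Ring ring using (-0#≈0#)

  DegreeBelow : P → ℕ → Set
  DegreeBelow p d = ∀ n → d ≤ n → coeff p n ≈ 0#

  DegreeBelow-mono : ∀ p {d d′} → d ≤ d′ → DegreeBelow p d → DegreeBelow p d′
  DegreeBelow-mono p d≤d′ p-below n d′≤n = p-below n (ℕ.≤-trans d≤d′ d′≤n)

  record Leading (p : P) (d : ℕ) (c : Carrier) : Set where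
    field
      coeff≈ : coeff p d ≈ c
      c≉0 : ¬ c ≈ 0#
      below : DegreeBelow p (suc d)
  open Leading

  Leading-∷ : ∀ {a p d c} → Leading p d c → Leading (a ∷ p) (suc d) c
  Leading-∷ leading = record
    { coeff≈ = coeff≈ leading ; c≉0 = c≉0 leading ; below = λ { (suc n) (s≤s d<n) → below leading n d<n } }

  zero-or-leading : ∀ p → p ≈ᶜ [] ⊎ ∃₂ (Leading p)
  zero-or-leading [] = inj₁ ≈ᶜ-refl
  zero-or-leading (a ∷ p) with zero-or-leading p
  ... | inj₂ (d , c , leading) = inj₂ (suc d , c , Leading-∷ leading)
  ... | inj₁ p≈0 with a ≈0?
  ...   | yes a≈0 = inj₁ (coeffwise λ { zero → a≈0 ; (suc n) → at p≈0 n })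
  ...   | no a≉0 = inj₂ (0 , a , record
          { coeff≈ = refl ; c≉0 = a≉0 ; below = λ { (suc n) _ → at p≈0 n } })

  Leading-resp : ∀ {p q d c} → p ≈ᶜ q → Leading p d c → Leading q d c
  Leading-resp {d = d} p≈q leading = record
    { coeff≈ = trans (sym (at p≈q d)) (coeff≈ leading)
    ; c≉0 = c≉0 leading
    ; below = λ n d<n → trans (sym (at p≈q n)) (below leading n d<n) }

  Leading-respᶜ : ∀ {p d c c′} → c ≈ c′ → Leading p d c → Leading p d c′
  Leading-respᶜ c≈c′ leading = record
    { coeff≈ = trans (coeff≈ leading) c≈c′
    ; c≉0 = λ c′≈0 → c≉0 leading (trans c≈c′ c′≈0)
    ; below = below leading }

  Leading⇒≉[] : ∀ {p d c} → Leading p d c → ¬ p ≈ᶜ []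
  Leading⇒≉[] {d = d} leading p≈0 = c≉0 leading (trans (sym (coeff≈ leading)) (at p≈0 d))

  Leading-+P-below : ∀ {p q d c} → Leading p d c → DegreeBelow q d → Leading (p +P q) d c
  Leading-+P-below {p} {q} {d} {c} leading q-below = record
    { coeff≈ = trans (coeff-+P p q d) (trans (+-cong (coeff≈ leading) (q-below d ℕ.≤-refl)) (+-identityʳ c))
    ; c≉0 = c≉0 leading
    ; below = λ n d<n → trans (coeff-+P p q n)
        (trans (+-cong (below leading n d<n) (q-below n (ℕ.<⇒≤ d<n))) (+-identityʳ 0#)) }

  Leading-+P : ∀ {p q d c c′} → Leading p d c → DegreeBelow q (suc d) → coeff q d ≈ c′ →
               ¬ c + c′ ≈ 0# → Leading (p +P q) d (c + c′)
  Leading-+P {p} {q} {d} leading q-below coeff≈c′ c+c′≉0 = record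
    { coeff≈ = trans (coeff-+P p q d) (+-cong (coeff≈ leading) coeff≈c′)
    ; c≉0 = c+c′≉0
    ; below = λ n d<n → trans (coeff-+P p q n)
        (trans (+-cong (below leading n d<n) (q-below n d<n)) (+-identityʳ 0#)) }

  Leading-scale : ∀ {a q d c} → ¬ a ≈ 0# → Leading q d c → Leading (scale a q) d (a * c)
  Leading-scale {a} {q} {d} a≉0 leading = record
    { coeff≈ = trans (coeff-scale a q d) (*-congˡ (coeff≈ leading))
    ; c≉0 = *-≉0 a≉0 (c≉0 leading)
    ; below = λ n d<n → trans (coeff-scale a q n) (trans (*-congˡ (below leading n d<n)) (zeroʳ a)) }

  Leading-*P : ∀ p {q d e c c′} → Leading p d c → Leading q e c′ → Leading (p *P q) (d ℕ.+ e) (c * c′)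
  Leading-*P [] leading _ = contradiction (sym (coeff≈ leading)) (c≉0 leading)
  Leading-*P (a ∷ p) {q} {zero} leading leading′ =
    Leading-respᶜ (*-congʳ (coeff≈ leading)) (Leading-resp (≈ᶜ-sym constant) (Leading-scale a≉0 leading′))
    where
    a≉0 : ¬ a ≈ 0#
    a≉0 a≈0 = c≉0 leading (trans (sym (coeff≈ leading)) a≈0)
    p≈0 : p ≈ᶜ []
    p≈0 = coeffwise λ n → below leading (suc n) (s≤s z≤n)
    constant : (a ∷ p) *P q ≈ᶜ scale a q
    constant = ≈ᶜ-trans (+P-cong ≈ᶜ-refl (≈ᶜ-trans (shift-cong (*P-congˡ q p≈0)) shift-[])) (+P-identityʳ _)
  Leading-*P (a ∷ p) {q} {suc d} {e} leading leading′ =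
    Leading-resp (+P-comm _ (scale a q))
      (Leading-+P-below {q = scale a q} (Leading-∷ (Leading-*P p leading-p leading′)) scale-below)
    where
    leading-p : Leading p d _
    leading-p = record
      { coeff≈ = coeff≈ leading ; c≉0 = c≉0 leading ; below = λ n d<n → below leading (suc n) (s≤s d<n) }
    scale-below : DegreeBelow (scale a q) (suc (d ℕ.+ e))
    scale-below n d+e<n = trans (coeff-scale a q n)
      (trans (*-congˡ (below leading′ n (ℕ.<-≤-trans (s≤s (ℕ.m≤n+m e d)) d+e<n))) (zeroʳ a))

  -P-below : ∀ q {d} → DegreeBelow q d → DegreeBelow (-P q) d
  -P-below q q-below n d≤n =
    trans (coeff--P q n) (trans (-‿cong (q-below n d≤n)) -0#≈0#)

  Leading-constant : ∀ {a c c′} → Leading a 0 c → c ≈ c′ → a ≈ᶜ [ c′ ]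
  Leading-constant leading c≈c′ = coeffwise λ
    { zero → trans (coeff≈ leading) c≈c′ ; (suc n) → below leading (suc n) (s≤s z≤n) }

  data Large[X] (a : P) : Set where
    nonconstant : ∀ {d c} → Leading a (suc d) c → Large[X] a
    large-constant : ∀ {c} → Leading a 0 c → Large c → Large[X] a

  large-or-small[X] : ∀ a → Large[X] a ⊎ Small (R [X]) a
  large-or-small[X] a with zero-or-leading a
  ... | inj₁ a≈0 = inj₂ (inj₁ (≈ᶜ⇒≈P a≈0))
  ... | inj₂ (suc d , c , leading) = inj₁ (nonconstant leading)
  ... | inj₂ (zero , c , leading) with large-or-small c
  ...   | inj₁ large = inj₁ (large-constant leading large)
  ...   | inj₂ (inj₁ c≈0) = contradiction c≈0 (c≉0 leading)
  ...   | inj₂ (inj₂ (inj₁ c≈1)) = inj₂ (inj₂ (inj₁ (≈ᶜ⇒≈P (Leading-constant leading c≈1))))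
  ...   | inj₂ (inj₂ (inj₂ c≈-1)) = inj₂ (inj₂ (inj₂ (≈ᶜ⇒≈P (Leading-constant leading c≈-1))))

  infix 4 _≻[X]_
  _≻[X]_ : P → P → Set
  p ≻[X] q = ∃₂ λ d c → Leading p d c × DegreeBelow q (suc d) × c ≻ coeff q d

  ≻[X]-grow : ∀ {a u v} → Large[X] a → u ≻[X] v → ((u *P a) +P (-P v)) ≻[X] u
  ≻[X]-grow {a} {u} {v} (nonconstant {e} {α} leading-a) (d , c , leading-u , v-below , c≻v) =
    d ℕ.+ suc e , c * α , leading , DegreeBelow-mono u (ℕ.<⇒≤ (s≤s d<d+1+e)) (below leading-u) ,
    ≻-resp-≈ refl (sym (below leading-u _ d<d+1+e)) (≉0⇒≻0 (*-≉0 (c≉0 leading-u) (c≉0 leading-a)))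
    where
    d<d+1+e : d < d ℕ.+ suc e
    d<d+1+e = ℕ.m<m+n d (s≤s z≤n)
    leading : Leading ((u *P a) +P (-P v)) (d ℕ.+ suc e) (c * α)
    leading = Leading-+P-below (Leading-*P u leading-u leading-a)
                               (-P-below v (DegreeBelow-mono v d<d+1+e v-below))
  ≻[X]-grow {a} {u} {v} (large-constant {α} leading-a large) (d , c , leading-u , v-below , c≻v) =
    d , c * α + - coeff v d , leading , below leading-u , ≻-resp-≈ refl (sym (coeff≈ leading-u)) grows
    where
    grows : c * α + - coeff v d ≻ c
    grows = ≻-grow large c≻v
    leading : Leading ((u *P a) +P (-P v)) d (c * α + - coeff v d)
    leading = Leading-+P (≡.subst (λ d′ → Leading (u *P a) d′ (c * α)) (ℕ.+-identityʳ d)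
                                  (Leading-*P u leading-u leading-a))
                         (-P-below v v-below) (coeff--P v d) (≻⇒≉0 grows)

  ≻[X]-resp : ∀ {p p′ q q′} → p ≈P p′ → q ≈P q′ → p ≻[X] q → p′ ≻[X] q′
  ≻[X]-resp p≈p′ q≈q′ (d , c , leading , q-below , c≻q) =
    d , c , Leading-resp (≈P⇒≈ᶜ p≈p′) leading ,
    (λ n d<n → trans (sym (at (≈P⇒≈ᶜ q≈q′) n)) (q-below n d<n)) ,
    ≻-resp-≈ refl (at (≈P⇒≈ᶜ q≈q′) d) c≻q

  ≉0⇒≻[X]0 : ∀ {p} → ¬ p ≈P [] → p ≻[X] []
  ≉0⇒≻[X]0 {p} p≉0 with zero-or-leading p
  ... | inj₁ p≈0 = contradiction (≈ᶜ⇒≈P p≈0) p≉0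
  ... | inj₂ (d , c , leading) = d , c , leading , (λ _ _ → refl) , ≉0⇒≻0 (c≉0 leading)

  *P-≉0 : ∀ {p q} → ¬ p ≈P [] → ¬ q ≈P [] → ¬ (p *P q) ≈P []
  *P-≉0 {p} {q} p≉0 q≉0 with zero-or-leading p | zero-or-leading q
  ... | inj₁ p≈0 | _ = contradiction (≈ᶜ⇒≈P p≈0) p≉0
  ... | _ | inj₁ q≈0 = contradiction (≈ᶜ⇒≈P q≈0) q≉0
  ... | inj₂ (_ , _ , leading) | inj₂ (_ , _ , leading′) =
    Leading⇒≉[] (Leading-*P p leading leading′) ∘ ≈P⇒≈ᶜ

  _≈P[]? : ∀ p → Dec (p ≈P [])
  p ≈P[]? with zero-or-leading p
  ... | inj₁ p≈0 = yes (≈ᶜ⇒≈P p≈0)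
  ... | inj₂ (_ , _ , leading) = no (Leading⇒≉[] leading ∘ ≈P⇒≈ᶜ)

  growthDomain[X] : GrowthDomain (R [X])
  growthDomain[X] = record
    { isCommutativeRing = isCommutativeRing[X]
    ; _≈0? = _≈P[]?
    ; 1≉0 = λ 1≈0 → 1≉0 (at (≈P⇒≈ᶜ 1≈0) 0)
    ; *-≉0 = *P-≉0
    ; Large = Large[X]
    ; large-or-small = large-or-small[X]
    ; _≻_ = _≻[X]_
    ; ≻-resp-≈ = ≻[X]-resp
    ; ≉0⇒≻0 = ≉0⇒≻[X]0
    ; ≻⇒≉0 = λ { (d , c , leading , _) p≈0 → Leading⇒≉[] leading (≈P⇒≈ᶜ p≈0) }
    ; ≻-grow = ≻[X]-grow }

growthDomain[X₁…X_] : ∀ {R} → GrowthDomain R → ∀ n → GrowthDomain (R [X₁…X n ])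
growthDomain[X₁…X G ] zero = G
growthDomain[X₁…X G ] (suc n) = GrowthDomain[X].growthDomain[X] (growthDomain[X₁…X G ] n)

private
  X+U≡W+V : ∀ U α V → 3 ℕ.* U ℕ.+ α ℕ.+ V ℕ.+ U ≡ 4 ℕ.* U ℕ.+ α ℕ.+ V
  X+U≡W+V = ℕ-Solver.solve-∀

  double-square : ∀ q → 2 ℕ.* q ℕ.* (2 ℕ.* q) ≡ 4 ℕ.* (q ℕ.* q)
  double-square = ℕ-Solver.solve-∀

  square-expansion : ∀ V μ α →
    (3 ℕ.* (suc V ℕ.+ μ) ℕ.+ α ℕ.+ V) ℕ.* (3 ℕ.* (suc V ℕ.+ μ) ℕ.+ α ℕ.+ V)
      ≡ 4 ℕ.* ((4 ℕ.* (suc V ℕ.+ μ) ℕ.+ α) ℕ.* V)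
        ℕ.+ (9 ℕ.* (suc μ ℕ.* suc μ) ℕ.+ α ℕ.* α
             ℕ.+ 8 ℕ.* (V ℕ.* suc μ) ℕ.+ 4 ℕ.* (V ℕ.* α) ℕ.+ 6 ℕ.* (suc μ ℕ.* α))
  square-expansion = ℕ-Solver.solve-∀

-- Squared out, this is √E ≥ √W - √V > 2√U - √U = √U.
sqrt-reverse-triangle : ∀ {U V W E q} → 4 ℕ.* U ℕ.≤ W → V ℕ.< U →
                        W ℕ.+ V ℕ.≤ E ℕ.+ 2 ℕ.* q → q ℕ.* q ℕ.≤ W ℕ.* V → U ℕ.< E
sqrt-reverse-triangle {U} {V} {W} {E} {q} 4U≤W V<U W+V≤E+2q q²≤WV
  with ℕ.m≤n⇒∃[o]m+o≡n 4U≤W | ℕ.m≤n⇒∃[o]m+o≡n V<U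
... | α , ≡.refl | μ , ≡.refl = ℕ.≰⇒> E≰U
  where
  X = 3 ℕ.* U ℕ.+ α ℕ.+ V
  E≰U : ¬ E ℕ.≤ U
  E≰U E≤U = ℕ.<⇒≱ 4WV<X² X²≤4WV
    where
    open ℕ.≤-Reasoning
    X≤2q : X ℕ.≤ 2 ℕ.* q
    X≤2q = ℕ.+-cancelʳ-≤ U X (2 ℕ.* q) (begin
      X ℕ.+ U            ≡⟨ X+U≡W+V U α V ⟩
      W ℕ.+ V            ≤⟨ W+V≤E+2q ⟩
      E ℕ.+ 2 ℕ.* q      ≤⟨ ℕ.+-monoˡ-≤ (2 ℕ.* q) E≤U ⟩
      U ℕ.+ 2 ℕ.* q      ≡⟨ ℕ.+-comm U (2 ℕ.* q) ⟩
      2 ℕ.* q ℕ.+ U      ∎)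
    X²≤4WV : X ℕ.* X ℕ.≤ 4 ℕ.* (W ℕ.* V)
    X²≤4WV = begin
      X ℕ.* X                 ≤⟨ ℕ.*-mono-≤ X≤2q X≤2q ⟩
      2 ℕ.* q ℕ.* (2 ℕ.* q)   ≡⟨ double-square q ⟩
      4 ℕ.* (q ℕ.* q)         ≤⟨ ℕ.*-monoʳ-≤ 4 q²≤WV ⟩
      4 ℕ.* (W ℕ.* V)         ∎
    4WV<X² : 4 ℕ.* (W ℕ.* V) ℕ.< X ℕ.* X
    4WV<X² =
      ≡.subst (4 ℕ.* (W ℕ.* V) ℕ.<_) (≡.sym (square-expansion V μ α)) (ℕ.m<m+n _ (s≤s z≤n))

module QuadraticIntegers (k : ℕ) where

  open RawRing ℤ[i√ k ]
  open ℤ-Solver using (solve-∀)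

  private
    *-assoc-re : ∀ (K a b c d e f : ℤ) →
      (a ℤ.* c ℤ.- K ℤ.* (b ℤ.* d)) ℤ.* e ℤ.- K ℤ.* ((a ℤ.* d ℤ.+ b ℤ.* c) ℤ.* f)
        ≡ a ℤ.* (c ℤ.* e ℤ.- K ℤ.* (d ℤ.* f)) ℤ.- K ℤ.* (b ℤ.* (c ℤ.* f ℤ.+ d ℤ.* e))
    *-assoc-re = solve-∀
    *-assoc-im : ∀ (K a b c d e f : ℤ) →
      (a ℤ.* c ℤ.- K ℤ.* (b ℤ.* d)) ℤ.* f ℤ.+ (a ℤ.* d ℤ.+ b ℤ.* c) ℤ.* e
        ≡ a ℤ.* (c ℤ.* f ℤ.+ d ℤ.* e) ℤ.+ b ℤ.* (c ℤ.* e ℤ.- K ℤ.* (d ℤ.* f))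
    *-assoc-im = solve-∀
    *-comm-re : ∀ (K a b c d : ℤ) → a ℤ.* c ℤ.- K ℤ.* (b ℤ.* d) ≡ c ℤ.* a ℤ.- K ℤ.* (d ℤ.* b)
    *-comm-re = solve-∀
    *-comm-im : ∀ (a b c d : ℤ) → a ℤ.* d ℤ.+ b ℤ.* c ≡ c ℤ.* b ℤ.+ d ℤ.* a
    *-comm-im = solve-∀
    *-identityˡ-re : ∀ (K a b : ℤ) → + 1 ℤ.* a ℤ.- K ℤ.* (+ 0 ℤ.* b) ≡ a
    *-identityˡ-re = solve-∀
    *-identityˡ-im : ∀ (a b : ℤ) → + 1 ℤ.* b ℤ.+ + 0 ℤ.* a ≡ b
    *-identityˡ-im = solve-∀
    distribˡ-re : ∀ (K a b c d e f : ℤ) →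
      a ℤ.* (c ℤ.+ e) ℤ.- K ℤ.* (b ℤ.* (d ℤ.+ f))
        ≡ (a ℤ.* c ℤ.- K ℤ.* (b ℤ.* d)) ℤ.+ (a ℤ.* e ℤ.- K ℤ.* (b ℤ.* f))
    distribˡ-re = solve-∀
    distribˡ-im : ∀ (a b c d e f : ℤ) →
      a ℤ.* (d ℤ.+ f) ℤ.+ b ℤ.* (c ℤ.+ e)
        ≡ (a ℤ.* d ℤ.+ b ℤ.* c) ℤ.+ (a ℤ.* f ℤ.+ b ℤ.* e)
    distribˡ-im = solve-∀

  *-comm : ∀ x y → x * y ≡ y * x
  *-comm (a , b) (c , d) = ≡.cong₂ _,_ (*-comm-re (+ k) a b c d) (*-comm-im a b c d)

  *-identityˡ : ∀ x → 1# * x ≡ x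
  *-identityˡ (a , b) = ≡.cong₂ _,_ (*-identityˡ-re (+ k) a b) (*-identityˡ-im a b)

  *-distribˡ-+ : ∀ x y z → x * (y + z) ≡ x * y + x * z
  *-distribˡ-+ (a , b) (c , d) (e , f) =
    ≡.cong₂ _,_ (distribˡ-re (+ k) a b c d e f) (distribˡ-im a b c d e f)

  isCommutativeRing : IsCommutativeRing _≡_ _+_ _*_ -_ 0# 1#
  isCommutativeRing = record
    { isRing = record
      { +-isAbelianGroup = record
        { isGroup = record
          { isMonoid = record
            { isSemigroup = record
              { isMagma = record { isEquivalence = ≡.isEquivalence ; ∙-cong = ≡.cong₂ _+_ }
              ; assoc = λ { (a , b) (c , d) (e , f) → ≡.cong₂ _,_ (ℤ.+-assoc a c e) (ℤ.+-assoc b d f) } }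
            ; identity = (λ { (a , b) → ≡.cong₂ _,_ (ℤ.+-identityˡ a) (ℤ.+-identityˡ b) })
                       , (λ { (a , b) → ≡.cong₂ _,_ (ℤ.+-identityʳ a) (ℤ.+-identityʳ b) }) }
          ; inverse = (λ { (a , b) → ≡.cong₂ _,_ (ℤ.+-inverseˡ a) (ℤ.+-inverseˡ b) })
                    , (λ { (a , b) → ≡.cong₂ _,_ (ℤ.+-inverseʳ a) (ℤ.+-inverseʳ b) })
          ; ⁻¹-cong = ≡.cong -_ }
        ; comm = λ { (a , b) (c , d) → ≡.cong₂ _,_ (ℤ.+-comm a c) (ℤ.+-comm b d) } }
      ; *-cong = ≡.cong₂ _*_
      ; *-assoc = λ { (a , b) (c , d) (e , f) →
                    ≡.cong₂ _,_ (*-assoc-re (+ k) a b c d e f) (*-assoc-im (+ k) a b c d e f) }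
      ; *-identity = *-identityˡ , λ x → ≡.trans (*-comm x 1#) (*-identityˡ x)
      ; distrib = *-distribˡ-+ , λ x y z → ≡.trans (*-comm (y + z) x)
                    (≡.trans (*-distribˡ-+ x y z) (≡.cong₂ _+_ (*-comm x y) (*-comm x z))) }
    ; *-comm = *-comm }

  conj : ℤ × ℤ → ℤ × ℤ
  conj (a , b) = (a , ℤ.- b)

  norm : ℤ × ℤ → ℕ
  norm (a , b) = ∣ a ∣ ℕ.* ∣ a ∣ ℕ.+ k ℕ.* (∣ b ∣ ℕ.* ∣ b ∣)

  private
    i*i≡+∣i∣*∣i∣ : ∀ i → i ℤ.* i ≡ + (∣ i ∣ ℕ.* ∣ i ∣)
    i*i≡+∣i∣*∣i∣ (+ n) = ≡.sym (ℤ.pos-* n n)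
    i*i≡+∣i∣*∣i∣ -[1+ n ] = ≡.refl

    norm-*-identity : ∀ (K a b c d : ℤ) →
      (a ℤ.* c ℤ.- K ℤ.* (b ℤ.* d)) ℤ.* (a ℤ.* c ℤ.- K ℤ.* (b ℤ.* d))
        ℤ.+ K ℤ.* ((a ℤ.* d ℤ.+ b ℤ.* c) ℤ.* (a ℤ.* d ℤ.+ b ℤ.* c))
        ≡ (a ℤ.* a ℤ.+ K ℤ.* (b ℤ.* b)) ℤ.* (c ℤ.* c ℤ.+ K ℤ.* (d ℤ.* d))
    norm-*-identity = solve-∀

    polar-identity : ∀ (K a b c d : ℤ) →
      (a ℤ.- c) ℤ.* (a ℤ.- c) ℤ.+ K ℤ.* ((b ℤ.- d) ℤ.* (b ℤ.- d))
        ℤ.+ + 2 ℤ.* (a ℤ.* c ℤ.- K ℤ.* (b ℤ.* ℤ.- d))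
        ≡ (a ℤ.* a ℤ.+ K ℤ.* (b ℤ.* b)) ℤ.+ (c ℤ.* c ℤ.+ K ℤ.* (d ℤ.* d))
    polar-identity = solve-∀

  +norm : ∀ a b → + norm (a , b) ≡ a ℤ.* a ℤ.+ + k ℤ.* (b ℤ.* b)
  +norm a b = begin
    + (∣ a ∣ ℕ.* ∣ a ∣ ℕ.+ k ℕ.* (∣ b ∣ ℕ.* ∣ b ∣))
      ≡⟨ ℤ.pos-+ (∣ a ∣ ℕ.* ∣ a ∣) _ ⟩
    + (∣ a ∣ ℕ.* ∣ a ∣) ℤ.+ + (k ℕ.* (∣ b ∣ ℕ.* ∣ b ∣))
      ≡⟨ ≡.cong (ℤ._+_ (+ (∣ a ∣ ℕ.* ∣ a ∣))) (ℤ.pos-* k _) ⟩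
    + (∣ a ∣ ℕ.* ∣ a ∣) ℤ.+ + k ℤ.* + (∣ b ∣ ℕ.* ∣ b ∣)
      ≡⟨ ≡.cong₂ (λ s t → s ℤ.+ + k ℤ.* t) (i*i≡+∣i∣*∣i∣ a) (i*i≡+∣i∣*∣i∣ b) ⟨
    a ℤ.* a ℤ.+ + k ℤ.* (b ℤ.* b) ∎
    where open ≡.≡-Reasoning

  norm-* : ∀ x y → norm (x * y) ≡ norm x ℕ.* norm y
  norm-* (a , b) (c , d) = ℤ.+-injective (begin
    + norm ((a , b) * (c , d))
      ≡⟨ +norm re im ⟩
    re ℤ.* re ℤ.+ + k ℤ.* (im ℤ.* im)
      ≡⟨ norm-*-identity (+ k) a b c d ⟩
    (a ℤ.* a ℤ.+ + k ℤ.* (b ℤ.* b)) ℤ.* (c ℤ.* c ℤ.+ + k ℤ.* (d ℤ.* d))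
      ≡⟨ ≡.cong₂ ℤ._*_ (+norm a b) (+norm c d) ⟨
    + norm (a , b) ℤ.* + norm (c , d)
      ≡⟨ ℤ.pos-* (norm (a , b)) (norm (c , d)) ⟨
    + (norm (a , b) ℕ.* norm (c , d)) ∎)
    where
    re = a ℤ.* c ℤ.- + k ℤ.* (b ℤ.* d)
    im = a ℤ.* d ℤ.+ b ℤ.* c
    open ≡.≡-Reasoning

  norm-conj : ∀ x → norm (conj x) ≡ norm x
  norm-conj (a , b) = ≡.cong (λ n → ∣ a ∣ ℕ.* ∣ a ∣ ℕ.+ k ℕ.* (n ℕ.* n)) (ℤ.∣-i∣≡∣i∣ b)

  norm-0# : norm 0# ≡ 0
  norm-0# = ℕ.*-zeroʳ k

  i≤+∣i∣ : ∀ i → i ℤ.≤ + ∣ i ∣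
  i≤+∣i∣ (+ n) = ℤ.≤-refl
  i≤+∣i∣ -[1+ n ] = ℤ.-≤+

  -- proj₁ (w * conj v) is the inner product w₁ v₁ + k w₂ v₂.
  polar : ∀ w v → norm w ℕ.+ norm v ℕ.≤ norm (w + - v) ℕ.+ 2 ℕ.* ∣ proj₁ (w * conj v) ∣
  polar (a , b) (c , d) = ℤ.drop‿+≤+ (begin
    + (norm (a , b) ℕ.+ norm (c , d))
      ≡⟨ ℤ.pos-+ (norm (a , b)) _ ⟩
    + norm (a , b) ℤ.+ + norm (c , d)
      ≡⟨ ≡.cong₂ ℤ._+_ (+norm a b) (+norm c d) ⟩
    (a ℤ.* a ℤ.+ + k ℤ.* (b ℤ.* b)) ℤ.+ (c ℤ.* c ℤ.+ + k ℤ.* (d ℤ.* d))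
      ≡⟨ polar-identity (+ k) a b c d ⟨
    (a ℤ.- c) ℤ.* (a ℤ.- c) ℤ.+ + k ℤ.* ((b ℤ.- d) ℤ.* (b ℤ.- d)) ℤ.+ + 2 ℤ.* p
      ≡⟨ ≡.cong (ℤ._+ + 2 ℤ.* p) (+norm (a ℤ.- c) (b ℤ.- d)) ⟨
    + E ℤ.+ + 2 ℤ.* p
      ≤⟨ ℤ.+-monoʳ-≤ (+ E) (ℤ.*-monoˡ-≤-nonNeg (+ 2) (i≤+∣i∣ p)) ⟩
    + E ℤ.+ + 2 ℤ.* + ∣ p ∣
      ≡⟨ ≡.cong (ℤ._+_ (+ E)) (ℤ.pos-* 2 ∣ p ∣) ⟨
    + E ℤ.+ + (2 ℕ.* ∣ p ∣)
      ≡⟨ ℤ.pos-+ E _ ⟨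
    + (E ℕ.+ 2 ℕ.* ∣ p ∣) ∎)
    where
    p = proj₁ ((a , b) * conj (c , d))
    E = norm ((a , b) + - (c , d))
    open ℤ.≤-Reasoning

  cauchy-schwarz : ∀ w v → ∣ proj₁ (w * conj v) ∣ ℕ.* ∣ proj₁ (w * conj v) ∣ ℕ.≤ norm w ℕ.* norm v
  cauchy-schwarz w v = ℕ.≤-trans (ℕ.m≤m+n _ _)
    (ℕ.≤-reflexive (≡.trans (norm-* w (conj v)) (≡.cong (norm w ℕ.*_) (norm-conj v))))

  large-re : ∀ a b → 2 ℕ.≤ ∣ a ∣ → 4 ℕ.≤ norm (a , b)
  large-re a b 2≤∣a∣ = ℕ.≤-trans (ℕ.*-mono-≤ 2≤∣a∣ 2≤∣a∣) (ℕ.m≤m+n _ _)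

  module _ (4≤k : 4 ℕ.≤ k) where

    large-im : ∀ a b → 1 ℕ.≤ ∣ b ∣ → 4 ℕ.≤ norm (a , b)
    large-im a b 1≤∣b∣ = ℕ.≤-trans 4≤k (ℕ.≤-trans k≤k*∣b∣² (ℕ.m≤n+m _ _))
      where
      k≤k*∣b∣² : k ℕ.≤ k ℕ.* (∣ b ∣ ℕ.* ∣ b ∣)
      k≤k*∣b∣² = ℕ.≤-trans (ℕ.≤-reflexive (≡.sym (ℕ.*-identityʳ k)))
                           (ℕ.*-monoʳ-≤ k (ℕ.*-mono-≤ 1≤∣b∣ 1≤∣b∣))

    norm≡0⇒≡0# : ∀ x → norm x ≡ 0 → x ≡ 0#
    norm≡0⇒≡0# (a , b) norm≡0 = ≡.cong₂ _,_
      (ℤ.∣i∣≡0⇒i≡0 (m*m≡0⇒m≡0 (ℕ.m+n≡0⇒m≡0 _ norm≡0)))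
      (ℤ.∣i∣≡0⇒i≡0 (m*m≡0⇒m≡0 (k*m≡0⇒m≡0 (ℕ.m+n≡0⇒n≡0 (∣ a ∣ ℕ.* ∣ a ∣) norm≡0))))
      where
      m*m≡0⇒m≡0 : ∀ {m} → m ℕ.* m ≡ 0 → m ≡ 0
      m*m≡0⇒m≡0 {m} m*m≡0 with ℕ.m*n≡0⇒m≡0∨n≡0 m m*m≡0
      ... | inj₁ m≡0 = m≡0
      ... | inj₂ m≡0 = m≡0
      k*m≡0⇒m≡0 : ∀ {m} → k ℕ.* m ≡ 0 → m ≡ 0
      k*m≡0⇒m≡0 {m} k*m≡0 with ℕ.m*n≡0⇒m≡0∨n≡0 k k*m≡0
      ... | inj₁ ≡.refl = contradiction 4≤k λ ()
      ... | inj₂ m≡0 = m≡0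

    0<norm : ∀ {x} → x ≢ 0# → 0 ℕ.< norm x
    0<norm {x} x≢0 = ℕ.n≢0⇒n>0 (x≢0 ∘ norm≡0⇒≡0# x)

    large-or-small : ∀ x → 4 ℕ.≤ norm x ⊎ Small ℤ[i√ k ] x
    large-or-small (a , + suc n) = inj₁ (large-im a (+ suc n) (s≤s z≤n))
    large-or-small (a , -[1+ n ]) = inj₁ (large-im a -[1+ n ] (s≤s z≤n))
    large-or-small (+ 0 , + 0) = inj₂ (inj₁ ≡.refl)
    large-or-small (+ 1 , + 0) = inj₂ (inj₂ (inj₁ ≡.refl))
    large-or-small (-[1+ 0 ] , + 0) = inj₂ (inj₂ (inj₂ ≡.refl))
    large-or-small (+ suc (suc n) , + 0) = inj₁ (large-re (+ suc (suc n)) (+ 0) (s≤s (s≤s z≤n)))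
    large-or-small (-[1+ suc n ] , + 0) = inj₁ (large-re -[1+ suc n ] (+ 0) (s≤s (s≤s z≤n)))

    growthDomain : GrowthDomain ℤ[i√ k ]
    growthDomain = record
      { isCommutativeRing = isCommutativeRing
      ; _≈0? = λ x → ≡-dec ℤ._≟_ ℤ._≟_ x 0#
      ; 1≉0 = λ ()
      ; *-≉0 = *-≢0
      ; Large = λ x → 4 ℕ.≤ norm x
      ; large-or-small = large-or-small
      ; _≻_ = λ x y → norm y ℕ.< norm x
      ; ≻-resp-≈ = λ { ≡.refl ≡.refl x≻y → x≻y }
      ; ≉0⇒≻0 = λ {x} x≢0 → ≡.subst (ℕ._< norm x) (≡.sym norm-0#) (0<norm x≢0)
      ; ≻⇒≉0 = λ { {y = y} y<x ≡.refl → ℕ.n≮0 (≡.subst (norm y ℕ.<_) norm-0# y<x) }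
      ; ≻-grow = λ {a} {u} {v} 4≤a v<u → sqrt-reverse-triangle {q = ∣ proj₁ (u * a * conj v) ∣}
          (4u≤ua u a 4≤a) v<u (polar (u * a) v) (cauchy-schwarz (u * a) v) }
      where
      *-≢0 : ∀ {x y} → x ≢ 0# → y ≢ 0# → x * y ≢ 0#
      *-≢0 {x} {y} x≢0 y≢0 xy≡0 = ℕ.<⇒≢ (ℕ.*-mono-< (0<norm x≢0) (0<norm y≢0))
        (≡.sym (≡.trans (≡.sym (norm-* x y)) (≡.trans (≡.cong norm xy≡0) norm-0#)))
      4u≤ua : ∀ u a → 4 ℕ.≤ norm a → 4 ℕ.* norm u ℕ.≤ norm (u * a)
      4u≤ua u a 4≤a = ℕ.≤-trans (ℕ.≤-reflexive (ℕ.*-comm 4 (norm u)))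
        (ℕ.≤-trans (ℕ.*-monoʳ-≤ (norm u) 4≤a) (ℕ.≤-reflexive (≡.sym (norm-* u a))))

proposition3p9 : (k : ℕ) → 4 ≤ k → (n : ℕ) → 1 ≤ n →
    (ℓ[ ℤ[i√ k ] ]≡ 4) × (ℓ[ ℤ[i√ k ] [X₁…X n ] ]≡ 4)
proposition3p9 k 4≤k n _ =
  GrowthDomainQuiddities.ℓ≡4 ℤ[i√k] , GrowthDomainQuiddities.ℓ≡4 (growthDomain[X₁…X ℤ[i√k] ] n)
  where
  ℤ[i√k] = QuadraticIntegers.growthDomain k 4≤k
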